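{- For every gadget $\gamma$ (mapping $\Pi$-structures to $\Sigma$-structures) there is a Datalog$^\cup$ reduction $\psi$ such that, for all $\Pi$-structures $\mathbf A$, $\gamma(\mathbf A)$ and $\psi(\mathbf A)$ are homomorphically equivalent.
   Context: Signatures and structures: a (multisorted relational) signature consists of types and relational symbols, each symbol $R$ with arity $\mathrm{ar}_R=(\mathrm{ar}_R(1),\dots,\mathrm{ar}_R(k))$, a tuple of types. A structure $\mathbf A$ has a set $A_t$ per type $t$ (elements of different types are distinct) and relations $R^{\mathbf A}\subseteq A_{\mathrm{ar}_R(1)}\times\dots\times A_{\mathrm{ar}_R(k)}$. A homomorphism is a family of type-wise maps preserving all relations; two structures are homomorphically equivalent if there are homomorphisms in both directions. Gadget $\gamma$ from $\Pi$ to $\Sigma$: a $\Sigma$-structure $\mathbf D_t$ for each $\Pi$-type $t$, a $\Sigma$-structure $\mathbf R^\gamma$ for each $\Pi$-symbol $R$, and a homomorphism $p_{R,i}\colon\mathbf D_{\mathrm{ar}_R(i)}\to\mathbf R^\gamma$ for each $\Pi$-symbol $R$ of arity $k$ and $i\in[k]$. The gadget replacement $\gamma(\mathbf A)$ of a $\Pi$-structure $\mathbf A$: take a copy of $\mathbf D_t$ (elements $(a;d)$) for every $a\in A_t$, and a copy of $\mathbf R^\gamma$ (elements $(a;e)$) for every $R$ and $a\in R^{\mathbf A}$; take the disjoint union of all copies and quotient by the equivalence generated by $(a;p_{R,i}(e))=(a_i;e)$ for all $R$, $a\in R^{\mathbf A}$, $i$, and $e\in\mathbf D_{\mathrm{ar}_R(i)}$;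 relations of $\gamma(\mathbf A)$ are the images of the relations of the copies. Datalog: typed variables; atomic formulas $R(x_1,\dots,x_k)$ (with $x_i$ of type $\mathrm{ar}_R(i)$) or $x=y$. A Datalog program with input signature $\Pi$: signature $\Delta\supseteq\Pi$ with the same types, finitely many rules $t_0\leftarrow t_1,\dots,t_r$ (atomic $\Delta$-formulas; heads use neither $\Pi$-symbols nor equality), a designated output symbol; evaluated by least fixed-point semantics, output the relation of the output symbol. Width = maximal number of variables in a rule. A Datalog interpretation $\phi$ from $\Pi$ to $\Sigma'$: programs $\phi_t$ for $\Sigma'$-types and $\phi_R$ for $\Sigma'$-symbols with the arity of $\phi_R$ the concatenation of arities of $\phi_{\mathrm{ar}_R(1)},\dots,\phi_{\mathrm{ar}_R(k)}$; $\phi(\mathbf A)$ has domains $\phi_t(\mathbf A)$ and $R^{\phi(\mathbf A)}$ the tuples $(w_1,\dots,w_k)$ with $w_i\in\phi_{\mathrm{ar}_R(i)}(\mathbf A)$ whose concatenation lies in $\phi_R(\mathbf A)$. A union gadget $(d,r)$ from $\Sigma'$ to $\Sigma$: $d$ maps $\Sigma'$-types to $\Sigma$-types, $r$ maps $\Sigma'$-symbols to $\Sigma$-symbols with $\mathrm{ar}_{r(R)}=d\circ\mathrm{ar}_R$; $\upsilon(\mathbf B)$ has domain of type $t$ the disjoint union of $B_i$ with $d(i)=t$ and $S^{\upsilon(\mathbf B)}=\bigcup_{r(R)=S}R^{\mathbf B}$. A Datalog$^\cup$ reduction is a composition $\upsilon\circ\phi$ of a Datalog interpretation and a union gadget. 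-}

module Defs where

open import Level using (0ℓ)
open import Data.Nat using (ℕ)
open import Data.Fin using (Fin)
open import Data.Bool using (Bool; T)
open import Data.Unit using (⊤)
open import Data.Product using (Σ; Σ-syntax; _×_; _,_; proj₁)
open import Data.Sum using (_⊎_; inj₁; inj₂)
open import Data.List using (List; []; _∷_; _++_)
import Data.List
open import Data.List.Relation.Unary.All as All using (All; []; _∷_)
open import Data.List.Membership.Propositional using (_∈_)
open import Data.List.Relation.Unary.All.Properties using (++⁺)
open import Relation.Binary using (Setoid; Rel)
open import Relation.Binary.PropositionalEquality as ≡ using (_≡_; refl; subst)
import Relation.Binary.Construct.On as On
import Relation.Binary.Construct.Closure.Equivalence as EqC

-- The arity of a symbol is a list of types; positions in it are given by
-- membership proofs  t ∈ ar R  (i.e. indices i ∈ [k] with ar_R(i) = t).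

record Signature : Set where
  field
    nTy  : ℕ
    nSym : ℕ
  Ty : Set
  Ty = Fin nTy
  Sym : Set
  Sym = Fin nSym
  field
    ar : Sym → List Ty
open Signature public

cmap : {A B : Set} → (A → List B) → List A → List B
cmap f []       = []
cmap f (x ∷ xs) = f x ++ cmap f xs

flatten : {A B : Set} {f : A → List B} {P : B → Set} {xs : List A} →
          All (λ a → All P (f a)) xs → All P (cmap f xs)
flatten []       = []
flatten (w ∷ ws) = ++⁺ w (flatten ws)

Pointwise : {A : Set} {P : A → Set} → (∀ {a} → P a → P a → Set) →
            {xs : List A} → All P xs → All P xs → Set
Pointwise R []       []       = ⊤
Pointwise R (x ∷ xs) (y ∷ ys) = R x y × Pointwise R xs ys

-- Structures.
-- A general structure: a set (presented as a setoid, so that quotients can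
-- be expressed) for each type, and a relation on tuples for each symbol.

record Structure (Σs : Signature) : Set₁ where
  field
    dom : Ty Σs → Setoid 0ℓ 0ℓ
  Elt : Ty Σs → Set
  Elt t = Setoid.Carrier (dom t)
  field
    rel : (R : Sym Σs) → All Elt (ar Σs R) → Set
open Structure public

record Hom {Σs : Signature} (A B : Structure Σs) : Set where
  field
    fun  : ∀ t → Elt A t → Elt B t
    cong : ∀ t {x y} → Setoid._≈_ (dom A t) x y →
           Setoid._≈_ (dom B t) (fun t x) (fun t y)
    pres : ∀ R (xs : All (Elt A) (ar Σs R)) → rel A R xs →
           rel B R (All.map (λ {t} → fun t) xs)
open Hom public

HomEquivalent : {Σs : Signature} → Structure Σs → Structure Σs → Set
HomEquivalent A B = Hom A B × Hom B A

record FinStructure (Σs : Signature) : Set where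
  field
    size : Ty Σs → ℕ
    frel : (R : Sym Σs) → All (λ t → Fin (size t)) (ar Σs R) → Bool
open FinStructure public

FElt : {Σs : Signature} → FinStructure Σs → Ty Σs → Set
FElt A t = Fin (size A t)

toStr : {Σs : Signature} → FinStructure Σs → Structure Σs
toStr A = record { dom = λ t → ≡.setoid (FElt A t)
                 ; rel = λ R xs → T (frel A R xs) }

record Gadget (Π Σs : Signature) : Set where
  field
    D   : Ty Π → FinStructure Σs
    Rg  : Sym Π → FinStructure Σs
    p   : (R : Sym Π) {t : Ty Π} → t ∈ ar Π R → Hom (toStr (D t)) (toStr (Rg R))
open Gadget public

module Replacement {Π Σs : Signature} (γ : Gadget Π Σs) (A : FinStructure Π) where

  -- elements of the disjoint union of all copies, of Σ-type s
  data GElt (s : Ty Σs) : Set where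
    vert : (t : Ty Π) (a : FElt A t) (d : FElt (D γ t) s) → GElt s
    edge : (R : Sym Π) (a : All (FElt A) (ar Π R)) → T (frel A R a) →
           (e : FElt (Rg γ R) s) → GElt s

  data Glue (s : Ty Σs) : GElt s → GElt s → Set where
    glue : (R : Sym Π) (a : All (FElt A) (ar Π R)) (pa : T (frel A R a))
           {t : Ty Π} (i : t ∈ ar Π R) (e : FElt (D γ t) s) →
           Glue s (edge R a pa (fun (p γ R i) s e)) (vert t (All.lookup a i) e)

  gdom : Ty Σs → Setoid 0ℓ 0ℓ
  gdom s = EqC.setoid (Glue s)

  _≈G_ : ∀ {s} → GElt s → GElt s → Set
  _≈G_ {s} = Setoid._≈_ (gdom s)

  -- relations: images (under the quotient map) of the relations of the copies
  grel : (S : Sym Σs) → All GElt (ar Σs S) → Set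
  grel S x =
      (Σ[ t ∈ Ty Π ] Σ[ a ∈ FElt A t ] Σ[ d ∈ All (FElt (D γ t)) (ar Σs S) ]
         (T (frel (D γ t) S d) × Pointwise _≈G_ x (All.map (λ {s} → vert t a) d)))
    ⊎ (Σ[ R ∈ Sym Π ] Σ[ a ∈ All (FElt A) (ar Π R) ] Σ[ pa ∈ T (frel A R a) ]
       Σ[ e ∈ All (FElt (Rg γ R)) (ar Σs S) ]
         (T (frel (Rg γ R) S e) × Pointwise _≈G_ x (All.map (λ {s} → edge R a pa) e)))

  structure : Structure Σs
  structure = record { dom = gdom ; rel = grel }

replace : {Π Σs : Signature} → Gadget Π Σs → FinStructure Π → Structure Σs
replace γ A = Replacement.structure γ A

module DatalogSyntax (Π : Signature) (nIdb : ℕ) (idbAr : Fin nIdb → List (Ty Π)) where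

  DSym : Set
  DSym = Sym Π ⊎ Fin nIdb

  arΔ : DSym → List (Ty Π)
  arΔ (inj₁ R) = ar Π R
  arΔ (inj₂ S) = idbAr S

  data Atom (nv : Ty Π → ℕ) : Set where
    atom : (S : DSym) → All (λ t → Fin (nv t)) (arΔ S) → Atom nv
    eq   : (t : Ty Π) → Fin (nv t) → Fin (nv t) → Atom nv

  record Rule : Set where
    field
      nv    : Ty Π → ℕ
      head  : Fin nIdb
      hargs : All (λ t → Fin (nv t)) (idbAr head)
      body  : List (Atom nv)
  open Rule public

record Program (Π : Signature) (out : List (Ty Π)) : Set where
  field
    nIdb   : ℕ
    idbAr  : Fin nIdb → List (Ty Π)
  open DatalogSyntax Π nIdb idbAr
  field
    rules  : List Rule
    outSym : DSym
    outOk  : arΔ outSym ≡ out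
open Program public

-- least fixed-point semantics: the relations of the non-input symbols are
-- the tuples derivable by finitely many rule applications
module DatalogSemantics {Π : Signature} {out : List (Ty Π)}
                        (P : Program Π out) (A : FinStructure Π) where
  open DatalogSyntax Π (nIdb P) (idbAr P)

  Tup : List (Ty Π) → Set
  Tup = All (FElt A)

  mutual
    data Derivable : (S : Fin (nIdb P)) → Tup (idbAr P S) → Set where
      derive : (r : Rule) → r ∈ rules P →
               (ρ : ∀ t → Fin (nv r t) → FElt A t) →
               All (Holds (nv r) ρ) (body r) →
               Derivable (head r) (All.map (λ {t} → ρ t) (hargs r))

    data Holds (n : Ty Π → ℕ) (ρ : ∀ t → Fin (n t) → FElt A t) : Atom n → Set where
      holdsIn  : (R : Sym Π) (xs : All (λ t → Fin (n t)) (ar Π R)) →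
                 T (frel A R (All.map (λ {t} → ρ t) xs)) → Holds n ρ (atom (inj₁ R) xs)
      holdsIdb : (S : Fin (nIdb P)) (xs : All (λ t → Fin (n t)) (idbAr P S)) →
                 Derivable S (All.map (λ {t} → ρ t) xs) → Holds n ρ (atom (inj₂ S) xs)
      holdsEq  : (t : Ty Π) (x y : Fin (n t)) → ρ t x ≡ ρ t y → Holds n ρ (eq t x y)

  RelΔ : (S : DSym) → Tup (arΔ S) → Set
  RelΔ (inj₁ R) xs = T (frel A R xs)
  RelΔ (inj₂ S) xs = Derivable S xs

  Output : Tup out → Set
  Output xs = RelΔ (outSym P) (subst Tup (≡.sym (outOk P)) xs)

record DatalogInterp (Π Σ' : Signature) : Set where
  field
    outT  : Ty Σ' → List (Ty Π)
    progT : (u : Ty Σ') → Program Π (outT u)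
    progR : (R : Sym Σ') → Program Π (cmap outT (ar Σ' R))
open DatalogInterp public

module Interpret {Π Σ' : Signature} (φ : DatalogInterp Π Σ') (A : FinStructure Π) where

  IElt : Ty Σ' → Set
  IElt u = Σ (All (FElt A) (outT φ u)) (DatalogSemantics.Output (progT φ u) A)

  idom : Ty Σ' → Setoid 0ℓ 0ℓ
  idom u = record { Carrier = IElt u ; _≈_ = λ x y → proj₁ x ≡ proj₁ y
                  ; isEquivalence = On.isEquivalence proj₁ ≡.isEquivalence }

  irel : (R : Sym Σ') → All IElt (ar Σ' R) → Set
  irel R w = DatalogSemantics.Output (progR φ R) A
               (flatten (All.map (λ {u} → proj₁) w))

  structure : Structure Σ'
  structure = record { dom = idom ; rel = irel }

interpret : {Π Σ' : Signature} → DatalogInterp Π Σ' → FinStructure Π → Structure Σ'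
interpret φ A = Interpret.structure φ A

record UnionGadget (Σ' Σs : Signature) : Set where
  field
    d    : Ty Σ' → Ty Σs
    r    : Sym Σ' → Sym Σs
    arOk : (R : Sym Σ') → ar Σs (r R) ≡ Data.List.map d (ar Σ' R)
open UnionGadget public

module UnionApply {Σ' Σs : Signature} (υ : UnionGadget Σ' Σs) (B : Structure Σ') where

  record UElt (s : Ty Σs) : Set where
    constructor uelt
    field
      src : Ty Σ'
      ok  : d υ src ≡ s
      val : Elt B src

  data _≈U_ {s : Ty Σs} : UElt s → UElt s → Set where
    ueq : ∀ {i p q x y} → Setoid._≈_ (dom B i) x y → uelt i p x ≈U uelt i q y

  udom : Ty Σs → Setoid 0ℓ 0ℓ
  udom s = record
    { Carrier = UElt s ; _≈_ = _≈U_
    ; isEquivalence = record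
      { refl  = λ {x} → ueq (Setoid.refl (dom B (UElt.src x)))
      ; sym   = λ { (ueq {i} e) → ueq (Setoid.sym (dom B i) e) }
      ; trans = λ { (ueq {i} e) (ueq e′) → ueq (Setoid.trans (dom B i) e e′) } } }

  data Match : {us : List (Ty Σs)} {ts : List (Ty Σ')} →
               All UElt us → All (Elt B) ts → Set where
    []  : Match [] []
    _∷_ : ∀ {u t us ts} {x : UElt u} {y : Elt B t}
            {xs : All UElt us} {ys : All (Elt B) ts} (e : d υ t ≡ u) →
          x ≈U uelt t e y → Match xs ys → Match (x ∷ xs) (y ∷ ys)

  urel : (S : Sym Σs) → All UElt (ar Σs S) → Set
  urel S x = Σ[ R ∈ Sym Σ' ] (r υ R ≡ S × Σ[ y ∈ All (Elt B) (ar Σ' R) ] (rel B R y × Match x y))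

  structure : Structure Σs
  structure = record { dom = udom ; rel = urel }

unionApply : {Σ' Σs : Signature} → UnionGadget Σ' Σs → Structure Σ' → Structure Σs
unionApply υ B = UnionApply.structure υ B

record DatalogUReduction (Π Σs : Signature) : Set where
  field
    mid    : Signature
    interp : DatalogInterp Π mid
    union  : UnionGadget mid Σs
open DatalogUReduction public

applyReduction : {Π Σs : Signature} → DatalogUReduction Π Σs → FinStructure Π → Structure Σs
applyReduction ψ A = unionApply (union ψ) (interpret (interp ψ) A)

module Submission where

-- ψ(A) is γ(A) before the identifications are made. The middle signature has one type for each
-- element of a gadget: the code V t s d names d ∈ D_t of Σ-type s, the code E R s e names e ∈ R^γ
-- of Σ-type s, and the domain of that type is the set of tuples indexing the copies (A_t, resp. R^A);
-- the union gadget sends it to s. For a Σ-symbol S and a choice of middle types at its positions, a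
-- Datalog program derives, on pairs of codes, the equivalence generated by (a; p_{R,i}(e)) = (a_i; e)
-- (glue rules closed under reflexivity, symmetry and transitivity), and outputs the tuples that are
-- equivalent, position by position, to a tuple of S inside a single copy. Every derivable fact holds
-- in γ(A), so sending a middle element to its class is a homomorphism ψ(A) → γ(A). Conversely every
-- instance of the generated equivalence is derivable, so sending an element of γ(A) to a canonical
-- member of its class is a homomorphism γ(A) → ψ(A); canonical members exist constructively because
-- there are finitely many elements before the quotient, with decidable equality, and finitely many
-- generating pairs, which can be merged one at a time.

open import Defs hiding (cong)
open import Level using (Level)
open import Data.Nat using (ℕ; zero; suc; _+_)
open import Data.Fin using (Fin; zero; suc; _↑ˡ_; _↑ʳ_; splitAt)
open import Data.Fin.Properties using (splitAt-↑ˡ; splitAt-↑ʳ) renaming (_≟_ to _≟ᶠ_)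
open import Data.Bool using (true; false; T)
open import Data.Bool.Properties using (T-irrelevant)
open import Data.Unit using (⊤; tt)
open import Data.Empty using (⊥-elim)
open import Data.Product using (Σ; _×_; _,_; proj₁; proj₂; uncurry)
open import Data.Sum as Sum using (_⊎_; inj₁; inj₂)
open import Data.List using (List; []; _∷_; _++_; map; allFin)
open import Data.List.Relation.Unary.All as All using (All; []; _∷_)
open import Data.List.Relation.Unary.All.Properties
  using (++⁺; ++⁻ˡ; ++⁻ʳ; lookup-map; map-cong; map-∘; map⁺)
open import Data.List.Relation.Unary.Any using (here; there)
open import Data.List.Membership.Propositional using (_∈_)
open import Data.List.Membership.Propositional.Properties using (∈-map⁺; ∈-allFin; ∈-++⁺ˡ; ∈-++⁺ʳ)
open import Function using (id)
open import Relation.Binary using (Setoid; IsEquivalence)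
open import Relation.Binary.Definitions using (DecidableEquality)
open import Relation.Binary.PropositionalEquality
import Relation.Binary.Construct.Closure.Equivalence as EqC
import Relation.Binary.Reasoning.Setoid as SetoidReasoning
open import Relation.Nullary using (Dec; yes; no; ¬_)
open import Axiom.UniquenessOfIdentityProofs.WithK using (uip)

-- Finite types

record Finite (A : Set) : Set where
  field
    card          : ℕ
    encode        : A → Fin card
    decode        : Fin card → A
    decode-encode : ∀ a → decode (encode a) ≡ a
open Finite public

finite-retract : {A B : Set} (f : A → B) (g : B → A) → (∀ a → g (f a) ≡ a) → Finite B → Finite A
finite-retract f g gf FB = record
  { card = card FB ; encode = λ a → encode FB (f a) ; decode = λ i → g (decode FB i)
  ; decode-encode = λ a → trans (cong g (decode-encode FB (f a))) (gf a) }

finite-Fin : ∀ n → Finite (Fin n)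
finite-Fin n = record { card = n ; encode = λ i → i ; decode = λ i → i ; decode-encode = λ _ → refl }

finite-⊤ : Finite ⊤
finite-⊤ = record { card = 1 ; encode = λ _ → zero ; decode = λ _ → tt ; decode-encode = λ _ → refl }

finite-empty : {A : Set} → ¬ A → Finite A
finite-empty ¬a = record
  { card = 0 ; encode = λ a → ⊥-elim (¬a a) ; decode = λ () ; decode-encode = λ a → ⊥-elim (¬a a) }

finite-⊎ : {A B : Set} → Finite A → Finite B → Finite (A ⊎ B)
finite-⊎ {A} {B} FA FB = record
  { card = card FA + card FB ; encode = encode⊎ ; decode = decode⊎ ; decode-encode = decode-encode⊎ }
  where
  encode⊎ : A ⊎ B → Fin (card FA + card FB)
  encode⊎ (inj₁ a) = encode FA a ↑ˡ card FB
  encode⊎ (inj₂ b) = card FA ↑ʳ encode FB b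
  decode⊎ : Fin (card FA + card FB) → A ⊎ B
  decode⊎ i = Sum.map (decode FA) (decode FB) (splitAt (card FA) i)
  decode-encode⊎ : ∀ x → decode⊎ (encode⊎ x) ≡ x
  decode-encode⊎ (inj₁ a) rewrite splitAt-↑ˡ (card FA) (encode FA a) (card FB) =
    cong inj₁ (decode-encode FA a)
  decode-encode⊎ (inj₂ b) rewrite splitAt-↑ʳ (card FA) (card FB) (encode FB b) =
    cong inj₂ (decode-encode FB b)

finite-ΣFin : ∀ n {B : Fin n → Set} → (∀ i → Finite (B i)) → Finite (Σ (Fin n) B)
finite-ΣFin zero    FB = finite-empty λ { (() , _) }
finite-ΣFin (suc n) {B} FB =
  finite-retract split join join-split (finite-⊎ (FB zero) (finite-ΣFin n (λ i → FB (suc i))))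
  where
  split : Σ (Fin (suc n)) B → B zero ⊎ Σ (Fin n) (λ i → B (suc i))
  split (zero  , b) = inj₁ b
  split (suc i , b) = inj₂ (i , b)
  join : B zero ⊎ Σ (Fin n) (λ i → B (suc i)) → Σ (Fin (suc n)) B
  join (inj₁ b)       = zero , b
  join (inj₂ (i , b)) = suc i , b
  join-split : ∀ x → join (split x) ≡ x
  join-split (zero  , b) = refl
  join-split (suc i , b) = refl

finite-Σ : {A : Set} {B : A → Set} → Finite A → (∀ a → Finite (B a)) → Finite (Σ A B)
finite-Σ {A} {B} FA FB =
  finite-retract toFin fromFin fromFin-toFin (finite-ΣFin (card FA) (λ i → FB (decode FA i)))
  where
  toFin : Σ A B → Σ (Fin (card FA)) (λ i → B (decode FA i))
  toFin (a , b) = encode FA a , subst B (sym (decode-encode FA a)) b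
  fromFin : Σ (Fin (card FA)) (λ i → B (decode FA i)) → Σ A B
  fromFin (i , b) = decode FA i , b
  fromFin-toFin : ∀ x → fromFin (toFin x) ≡ x
  fromFin-toFin (a , b) with decode FA (encode FA a) | decode-encode FA a
  ... | _ | refl = refl

finite-× : {A B : Set} → Finite A → Finite B → Finite (A × B)
finite-× FA FB = finite-Σ FA (λ _ → FB)

finite-T : ∀ b → Finite (T b)
finite-T true  = finite-⊤
finite-T false = finite-empty (λ ())

finite-≡ : {A : Set} {x y : A} → Dec (x ≡ y) → Finite (x ≡ y)
finite-≡ (no x≢y) = finite-empty x≢y
finite-≡ (yes x≡y) = record
  { card = 1 ; encode = λ _ → zero ; decode = λ _ → x≡y ; decode-encode = λ e → uip x≡y e }

finite-All : {X : Set} {P : X → Set} (xs : List X) → (∀ x → Finite (P x)) → Finite (All P xs)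
finite-All []       FP = finite-retract (λ _ → tt) (λ _ → []) (λ { [] → refl }) finite-⊤
finite-All (x ∷ xs) FP = finite-retract (λ { (p ∷ ps) → p , ps }) (λ { (p , ps) → p ∷ ps })
  (λ { (p ∷ ps) → refl }) (finite-× (FP x) (finite-All xs FP))

finite-∈ : {X : Set} (xs : List X) → Finite (Σ X (_∈ xs))
finite-∈ []           = finite-empty λ { (_ , ()) }
finite-∈ {X} (x ∷ xs) = finite-retract split join join-split (finite-⊎ finite-⊤ (finite-∈ xs))
  where
  split : Σ X (_∈ x ∷ xs) → ⊤ ⊎ Σ X (_∈ xs)
  split (_ , here refl) = inj₁ tt
  split (t , there p)   = inj₂ (t , p)
  join : ⊤ ⊎ Σ X (_∈ xs) → Σ X (_∈ x ∷ xs)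
  join (inj₁ _)       = x , here refl
  join (inj₂ (t , p)) = t , there p
  join-split : ∀ a → join (split a) ≡ a
  join-split (_ , here refl) = refl
  join-split (_ , there p)   = refl

enumerate : {A : Set} → Finite A → List A
enumerate F = map (decode F) (allFin (card F))

∈-enumerate : {A : Set} (F : Finite A) (a : A) → a ∈ enumerate F
∈-enumerate F a =
  subst (_∈ enumerate F) (decode-encode F a) (∈-map⁺ (decode F) (∈-allFin (encode F a)))

≟-finite : {A : Set} → Finite A → DecidableEquality A
≟-finite F a b with encode F a ≟ᶠ encode F b
... | yes e = yes (trans (sym (decode-encode F a)) (trans (cong (decode F) e) (decode-encode F b)))
... | no ¬e = no (λ a≡b → ¬e (cong (encode F) a≡b))

-- Selecting components of tuples

module _ {X : Set} {P Q : X → Set} where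

  map-++⁺ : ∀ {xs ys} (f : ∀ {x} → P x → Q x) (pxs : All P xs) (pys : All P ys) →
            All.map f (++⁺ pxs pys) ≡ ++⁺ (All.map f pxs) (All.map f pys)
  map-++⁺ f []         pys = refl
  map-++⁺ f (px ∷ pxs) pys = cong (f px ∷_) (map-++⁺ f pxs pys)

module _ {X : Set} where

  positions : (L : List X) → All (_∈ L) L
  positions []      = []
  positions (x ∷ L) = here refl ∷ All.map there (positions L)

  lookup-positions : ∀ {L t} (p : t ∈ L) → All.lookup (positions L) p ≡ p
  lookup-positions         (here refl) = refl
  lookup-positions {_ ∷ L} (there p)   =
    trans (lookup-map (positions L) p) (cong there (lookup-positions p))

  leftPositions : (L₁ L₂ : List X) → All (_∈ L₁ ++ L₂) L₁
  leftPositions L₁ L₂ = All.map ∈-++⁺ˡ (positions L₁)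

  rightPositions : (L₁ L₂ : List X) → All (_∈ L₁ ++ L₂) L₂
  rightPositions L₁ L₂ = All.map (∈-++⁺ʳ L₁) (positions L₂)

  module _ (L₁ L₂ L₃ : List X) where

    firstPositions : All (_∈ L₁ ++ L₂ ++ L₃) L₁
    firstPositions = leftPositions L₁ (L₂ ++ L₃)

    secondPositions : All (_∈ L₁ ++ L₂ ++ L₃) L₂
    secondPositions = All.map (∈-++⁺ʳ L₁) (leftPositions L₂ L₃)

    thirdPositions : All (_∈ L₁ ++ L₂ ++ L₃) L₃
    thirdPositions = All.map (∈-++⁺ʳ L₁) (rightPositions L₂ L₃)

  blockPositions : {B : Set} (f : B → List X) (bs : List B) → All (λ b → All (_∈ cmap f bs) (f b)) bs
  blockPositions f []       = []
  blockPositions f (b ∷ bs) =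
    leftPositions (f b) (cmap f bs) ∷ All.map (All.map (∈-++⁺ʳ (f b))) (blockPositions f bs)

  module _ {El : X → Set} where

    select : ∀ {L ts} → All El L → All (_∈ L) ts → All El ts
    select v ps = All.map (All.lookup v) ps

    ++⁻ˡ-++⁺ : ∀ {L₁ L₂} (v : All El L₁) (w : All El L₂) → ++⁻ˡ L₁ (++⁺ v w) ≡ v
    ++⁻ˡ-++⁺ []      w = refl
    ++⁻ˡ-++⁺ (x ∷ v) w = cong (x ∷_) (++⁻ˡ-++⁺ v w)

    ++⁻ʳ-++⁺ : ∀ {L₁ L₂} (v : All El L₁) (w : All El L₂) → ++⁻ʳ L₁ (++⁺ v w) ≡ w
    ++⁻ʳ-++⁺ []      w = refl
    ++⁻ʳ-++⁺ (x ∷ v) w = ++⁻ʳ-++⁺ v w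

    select-map : ∀ {L L′ ts} (v : All El L′) (w : All El L) (f : ∀ {t} → t ∈ L → t ∈ L′) →
                 (∀ {t} (p : t ∈ L) → All.lookup v (f p) ≡ All.lookup w p) →
                 (ps : All (_∈ L) ts) → select v (All.map f ps) ≡ select w ps
    select-map v w f v∘f≗w []       = refl
    select-map v w f v∘f≗w (p ∷ ps) = cong₂ _∷_ (v∘f≗w p) (select-map v w f v∘f≗w ps)

    lookup-++⁺-∈ˡ : ∀ {L₁ L₂ t} (v : All El L₁) (w : All El L₂) (p : t ∈ L₁) →
                    All.lookup (++⁺ v w) (∈-++⁺ˡ p) ≡ All.lookup v p
    lookup-++⁺-∈ˡ (x ∷ v) w (here refl) = refl
    lookup-++⁺-∈ˡ (x ∷ v) w (there p)   = lookup-++⁺-∈ˡ v w p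

    lookup-++⁺-∈ʳ : ∀ {L₁ L₂ t} (v : All El L₁) (w : All El L₂) (p : t ∈ L₂) →
                    All.lookup (++⁺ v w) (∈-++⁺ʳ L₁ p) ≡ All.lookup w p
    lookup-++⁺-∈ʳ []      w p = refl
    lookup-++⁺-∈ʳ (x ∷ v) w p = lookup-++⁺-∈ʳ v w p

    select-positions : ∀ {L} (v : All El L) → select v (positions L) ≡ v
    select-positions []      = refl
    select-positions (x ∷ v) =
      cong (x ∷_) (trans (select-map (x ∷ v) v there (λ _ → refl) (positions _)) (select-positions v))

    select-∈-++⁺ˡ : ∀ {L₁ L₂ ts} (v : All El L₁) (w : All El L₂) (ps : All (_∈ L₁) ts) →
                    select (++⁺ v w) (All.map ∈-++⁺ˡ ps) ≡ select v ps
    select-∈-++⁺ˡ v w = select-map (++⁺ v w) v ∈-++⁺ˡ (lookup-++⁺-∈ˡ v w)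

    select-∈-++⁺ʳ : ∀ {L₁ L₂ ts} (v : All El L₁) (w : All El L₂) (ps : All (_∈ L₂) ts) →
                    select (++⁺ v w) (All.map (∈-++⁺ʳ L₁) ps) ≡ select w ps
    select-∈-++⁺ʳ {L₁} v w = select-map (++⁺ v w) w (∈-++⁺ʳ L₁) (lookup-++⁺-∈ʳ v w)

    select-leftPositions : ∀ {L₁ L₂} (v : All El L₁) (w : All El L₂) →
                           select (++⁺ v w) (leftPositions L₁ L₂) ≡ v
    select-leftPositions v w = trans (select-∈-++⁺ˡ v w (positions _)) (select-positions v)

    select-rightPositions : ∀ {L₁ L₂} (v : All El L₁) (w : All El L₂) →
                            select (++⁺ v w) (rightPositions L₁ L₂) ≡ w
    select-rightPositions v w = trans (select-∈-++⁺ʳ v w (positions _)) (select-positions w)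

    module _ {L₁ L₂ L₃} (u : All El L₁) (v : All El L₂) (w : All El L₃) where

      select-firstPositions : select (++⁺ u (++⁺ v w)) (firstPositions L₁ L₂ L₃) ≡ u
      select-firstPositions = select-leftPositions u (++⁺ v w)

      select-secondPositions : select (++⁺ u (++⁺ v w)) (secondPositions L₁ L₂ L₃) ≡ v
      select-secondPositions = trans (select-∈-++⁺ʳ u (++⁺ v w) _) (select-leftPositions v w)

      select-thirdPositions : select (++⁺ u (++⁺ v w)) (thirdPositions L₁ L₂ L₃) ≡ w
      select-thirdPositions = trans (select-∈-++⁺ʳ u (++⁺ v w) _) (select-rightPositions v w)

    select-blockPositions : {B : Set} (f : B → List X) {bs : List B} (ws : All (λ b → All El (f b)) bs) →
                            All.map (select (flatten ws)) (blockPositions f bs) ≡ ws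
    select-blockPositions f []                = refl
    select-blockPositions f {b ∷ bs} (w ∷ ws) = cong₂ _∷_ (select-leftPositions w (flatten ws)) (begin
      All.map (select (++⁺ w (flatten ws))) (All.map (All.map (∈-++⁺ʳ (f b))) B)
        ≡⟨ map-∘ B ⟩
      All.map (λ ps → select (++⁺ w (flatten ws)) (All.map (∈-++⁺ʳ (f b)) ps)) B
        ≡⟨ map-cong B (select-∈-++⁺ʳ w (flatten ws)) ⟩
      All.map (select (flatten ws)) B
        ≡⟨ select-blockPositions f ws ⟩
      ws ∎)
      where
      open ≡-Reasoning
      B = blockPositions f bs

    select-∈-++⁺ˡ-leftPositions : ∀ {L₁ L₂ ts} (v : All El (L₁ ++ L₂)) (ps : All (_∈ L₁) ts) →
                                  select v (All.map ∈-++⁺ˡ ps)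
                                    ≡ select (select v (leftPositions L₁ L₂)) ps
    select-∈-++⁺ˡ-leftPositions {L₁} {L₂} v =
      select-map v (select v (leftPositions L₁ L₂)) ∈-++⁺ˡ λ p → sym (begin
      All.lookup (All.map (All.lookup v) (All.map ∈-++⁺ˡ (positions L₁))) p
        ≡⟨ lookup-map (All.map ∈-++⁺ˡ (positions L₁)) p ⟩
      All.lookup v (All.lookup (All.map ∈-++⁺ˡ (positions L₁)) p)
        ≡⟨ cong (All.lookup v) (lookup-map (positions L₁) p) ⟩
      All.lookup v (∈-++⁺ˡ (All.lookup (positions L₁) p))
        ≡⟨ cong (λ q → All.lookup v (∈-++⁺ˡ q)) (lookup-positions p) ⟩
      All.lookup v (∈-++⁺ˡ p) ∎)
      where open ≡-Reasoning

-- A rule over a list L of types has one variable per entry of L: the variables of type t are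
-- the occurrences of t in L, and the occurrence p : t ∈ L is the variable varOf p.
module RuleVariables {X : Set} (_≟_ : DecidableEquality X) where

  occurrences : List X → X → ℕ
  occurrences []      _ = 0
  occurrences (u ∷ L) t with u ≟ t
  ... | yes _ = suc (occurrences L t)
  ... | no  _ = occurrences L t

  varOf : ∀ {L t} → t ∈ L → Fin (occurrences L t)
  varOf {_ ∷ L} {t} (here refl) with t ≟ t
  ... | yes _   = zero
  ... | no  t≢t = ⊥-elim (t≢t refl)
  varOf {u ∷ L} {t} (there p) with u ≟ t
  ... | yes _ = suc (varOf p)
  ... | no  _ = varOf p

  vars : ∀ {L ts} → All (_∈ L) ts → All (λ t → Fin (occurrences L t)) ts
  vars ps = All.map varOf ps

  module _ {El : X → Set} where

    env : ∀ {L} → All El L → ∀ t → Fin (occurrences L t) → El t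
    env {u ∷ L} (x ∷ v) t j with u ≟ t
    env {u ∷ L} (x ∷ v) t zero    | yes refl = x
    env {u ∷ L} (x ∷ v) t (suc j) | yes refl = env v t j
    ... | no _ = env v t j

    env-varOf : ∀ {L t} (v : All El L) (p : t ∈ L) → env v t (varOf p) ≡ All.lookup v p
    env-varOf {_ ∷ L} {t} (x ∷ v) (here refl) with t ≟ t
    ... | yes refl = refl
    ... | no  t≢t  = ⊥-elim (t≢t refl)
    env-varOf {u ∷ L} {t} (x ∷ v) (there p) with u ≟ t
    ... | yes refl = env-varOf v p
    ... | no  _    = env-varOf v p

    instantiate : ∀ {L ts} → (∀ t → Fin (occurrences L t) → El t) → All (_∈ L) ts → All El ts
    instantiate ρ ps = All.map (λ {t} → ρ t) (vars ps)

    instantiate-env : ∀ {L ts} (v : All El L) (ps : All (_∈ L) ts) → instantiate (env v) ps ≡ select v ps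
    instantiate-env v ps = trans (map-∘ ps) (map-cong ps (env-varOf v))

    slots : ∀ {L} → (∀ t → Fin (occurrences L t) → El t) → All El L
    slots {L} ρ = instantiate ρ (positions L)

    instantiate-slots : ∀ {L ts} (ρ : ∀ t → Fin (occurrences L t) → El t) (ps : All (_∈ L) ts) →
                        instantiate ρ ps ≡ select (slots ρ) ps
    instantiate-slots {L} ρ ps = trans (map-∘ ps) (map-cong ps (λ p → sym (lookup-slots p)))
      where
      lookup-slots : ∀ {t} (p : t ∈ L) → All.lookup (slots ρ) p ≡ ρ t (varOf p)
      lookup-slots p = begin
        All.lookup (All.map (λ {t} → ρ t) (vars (positions L))) p
          ≡⟨ lookup-map (vars (positions L)) p ⟩
        ρ _ (All.lookup (All.map varOf (positions L)) p)
          ≡⟨ cong (ρ _) (lookup-map (positions L) p) ⟩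
        ρ _ (varOf (All.lookup (positions L) p))
          ≡⟨ cong (λ q → ρ _ (varOf q)) (lookup-positions p) ⟩
        ρ _ (varOf p) ∎
        where open ≡-Reasoning

module Representatives {c ℓ : Level} (S : Setoid c ℓ) (_≟_ : DecidableEquality (Setoid.Carrier S)) where
  open Setoid S using (Carrier; _≈_) renaming (refl to ≈-refl; sym to ≈-sym)

  redirect : (Carrier → Carrier) → Carrier × Carrier → Carrier → Carrier
  redirect f (x , y) z with z ≟ f x
  ... | yes _ = f y
  ... | no  _ = z

  representative : List (Carrier × Carrier) → Carrier → Carrier
  representative []       z = z
  representative (q ∷ qs) z = redirect (representative qs) q (representative qs z)

  representative-identifies : ∀ {x y} qs → (x , y) ∈ qs → representative qs x ≡ representative qs y
  representative-identifies {x} {y} (_ ∷ qs) (here refl) with representative qs x ≟ representative qs x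
  ... | no  r≢r = ⊥-elim (r≢r refl)
  ... | yes _ with representative qs y ≟ representative qs x
  ...   | yes _ = refl
  ...   | no  _ = refl
  representative-identifies (q ∷ qs) (there p) =
    cong (redirect (representative qs) q) (representative-identifies qs p)

  representative-≈ : ∀ {qs} → All (uncurry _≈_) qs → ∀ z → representative qs z ≈ z
  representative-≈ []                       z = ≈-refl
  representative-≈ {(x , y) ∷ qs} (x≈y ∷ ok) z with representative qs z ≟ representative qs x
  ... | no  _  = representative-≈ ok z
  ... | yes r≡ = begin
    representative qs y ≈⟨ representative-≈ ok y ⟩
    y                   ≈⟨ ≈-sym x≈y ⟩
    x                   ≈⟨ ≈-sym (representative-≈ ok x) ⟩
    representative qs x ≡⟨ sym r≡ ⟩
    representative qs z ≈⟨ representative-≈ ok z ⟩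
    z                   ∎
    where open SetoidReasoning S

module Construction {Π Σs : Signature} (γ : Gadget Π Σs) where
  open RuleVariables (_≟ᶠ_ {nTy Π}) public

  data Code : Set where
    V : (t : Ty Π) (s : Ty Σs) → FElt (D γ t) s → Code
    E : (R : Sym Π) (s : Ty Σs) → FElt (Rg γ R) s → Code

  sort : Code → Ty Σs
  sort (V t s d) = s
  sort (E R s e) = s

  indexTypes : Code → List (Ty Π)
  indexTypes (V t s d) = t ∷ []
  indexTypes (E R s e) = ar Π R

  finite-Code : Finite Code
  finite-Code = finite-retract split join join-split
    (finite-⊎ (finite-Σ (finite-Fin _) λ t → finite-Σ (finite-Fin _) λ s → finite-Fin (size (D γ t) s))
              (finite-Σ (finite-Fin _) λ R → finite-Σ (finite-Fin _) λ s → finite-Fin (size (Rg γ R) s)))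
    where
    split : Code → _
    split (V t s d) = inj₁ (t , s , d)
    split (E R s e) = inj₂ (R , s , e)
    join : _ → Code
    join (inj₁ (t , s , d)) = V t s d
    join (inj₂ (R , s , e)) = E R s e
    join-split : ∀ c → join (split c) ≡ c
    join-split (V t s d) = refl
    join-split (E R s e) = refl

  MidTy : Set
  MidTy = Fin (card finite-Code)

  codeOf : MidTy → Code
  codeOf = decode finite-Code

  midArgs : MidTy → List (Ty Π)
  midArgs u = indexTypes (codeOf u)

  domainRule : (t : Ty Π) → DatalogSyntax.Rule Π 1 (λ _ → t ∷ [])
  domainRule t = record { nv = occurrences (t ∷ []) ; head = zero ; hargs = vars (here refl ∷ []) ; body = [] }

  domainProgram : (c : Code) → Program Π (indexTypes c)
  domainProgram (V t s d) = record
    { nIdb = 1 ; idbAr = λ _ → t ∷ [] ; rules = domainRule t ∷ [] ; outSym = inj₂ zero ; outOk = refl }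
  domainProgram (E R s e) = record
    { nIdb = 0 ; idbAr = λ () ; rules = [] ; outSym = inj₁ R ; outOk = refl }

  MidTyOfSort : Ty Σs → Set
  MidTyOfSort s = Σ MidTy (λ u → sort (codeOf u) ≡ s)

  SymCode : Set
  SymCode = Σ (Sym Σs) (λ S → All MidTyOfSort (ar Σs S))

  finite-SymCode : Finite SymCode
  finite-SymCode = finite-Σ (finite-Fin _) λ S → finite-All (ar Σs S) λ s →
    finite-Σ (finite-Fin _) λ u → finite-≡ (sort (codeOf u) ≟ᶠ s)

  midTypes : ∀ {ss} → All MidTyOfSort ss → List MidTy
  midTypes = All.reduce proj₁

  midSig : Signature
  midSig = record { nTy = card finite-Code ; nSym = card finite-SymCode
                  ; ar = λ R′ → midTypes (proj₂ (decode finite-SymCode R′)) }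

  sorts-midTypes : ∀ {ss} (ms : All MidTyOfSort ss) → ss ≡ map (λ u → sort (codeOf u)) (midTypes ms)
  sorts-midTypes []             = refl
  sorts-midTypes ((u , e) ∷ ms) = cong₂ _∷_ (sym e) (sorts-midTypes ms)

  unionGadget : UnionGadget midSig Σs
  unionGadget = record { d = λ u → sort (codeOf u) ; r = λ R′ → proj₁ (decode finite-SymCode R′)
                       ; arOk = λ R′ → sorts-midTypes (proj₂ (decode finite-SymCode R′)) }

  finite-CodePair : Finite (Code × Code)
  finite-CodePair = finite-× finite-Code finite-Code

  pairArgs : Code × Code → List (Ty Π)
  pairArgs (c , c′) = indexTypes c ++ indexTypes c′

  data RuleName (S : Sym Σs) : Set where
    glueing      : (R : Sym Π) {t : Ty Π} → t ∈ ar Π R → (s : Ty Σs) → FElt (D γ t) s → RuleName S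
    reflexivity  : Code → RuleName S
    symmetry     : Code → Code → RuleName S
    transitivity : Code → Code → Code → RuleName S
    outputD      : (t : Ty Π) (d : All (FElt (D γ t)) (ar Σs S)) → T (frel (D γ t) S d) → RuleName S
    outputR      : (R : Sym Π) (e : All (FElt (Rg γ R)) (ar Σs S)) → T (frel (Rg γ R) S e) → RuleName S

  finite-RuleName : ∀ S → Finite (RuleName S)
  finite-RuleName S = finite-retract split join join-split
    (finite-⊎ (finite-Σ (finite-Fin _) λ R → finite-Σ (finite-∈ (ar Π R)) λ ti →
                 finite-Σ (finite-Fin _) λ s → finite-Fin (size (D γ (proj₁ ti)) s))
    (finite-⊎ finite-Code
    (finite-⊎ (finite-× finite-Code finite-Code)
    (finite-⊎ (finite-× finite-Code (finite-× finite-Code finite-Code))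
    (finite-⊎ (finite-Σ (finite-Fin _) λ t → finite-Σ (finite-All _ λ _ → finite-Fin _) λ d → finite-T _)
              (finite-Σ (finite-Fin _) λ R → finite-Σ (finite-All _ λ _ → finite-Fin _) λ e → finite-T _))))))
    where
    split : RuleName S → _
    split (glueing R i s e)      = inj₁ (R , (_ , i) , s , e)
    split (reflexivity c)        = inj₂ (inj₁ c)
    split (symmetry c c′)        = inj₂ (inj₂ (inj₁ (c , c′)))
    split (transitivity c c′ c″) = inj₂ (inj₂ (inj₂ (inj₁ (c , c′ , c″))))
    split (outputD t d ok)       = inj₂ (inj₂ (inj₂ (inj₂ (inj₁ (t , d , ok)))))
    split (outputR R e ok)       = inj₂ (inj₂ (inj₂ (inj₂ (inj₂ (R , e , ok)))))
    join : _ → RuleName S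
    join (inj₁ (R , (_ , i) , s , e))                    = glueing R i s e
    join (inj₂ (inj₁ c))                                 = reflexivity c
    join (inj₂ (inj₂ (inj₁ (c , c′))))                   = symmetry c c′
    join (inj₂ (inj₂ (inj₂ (inj₁ (c , c′ , c″)))))       = transitivity c c′ c″
    join (inj₂ (inj₂ (inj₂ (inj₂ (inj₁ (t , d , ok)))))) = outputD t d ok
    join (inj₂ (inj₂ (inj₂ (inj₂ (inj₂ (R , e , ok)))))) = outputR R e ok
    join-split : ∀ n → join (split n) ≡ n
    join-split (glueing R i s e)      = refl
    join-split (reflexivity c)        = refl
    join-split (symmetry c c′)        = refl
    join-split (transitivity c c′ c″) = refl
    join-split (outputD t d ok)       = refl
    join-split (outputR R e ok)       = refl

  module SymbolProgram (k : SymCode) where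

    S₀ : Sym Σs
    S₀ = proj₁ k

    ms₀ : All MidTyOfSort (ar Σs S₀)
    ms₀ = proj₂ k

    outArgs : List (Ty Π)
    outArgs = cmap midArgs (midTypes ms₀)

    IdbSym : Set
    IdbSym = Fin (suc (card finite-CodePair))

    idbArity : IdbSym → List (Ty Π)
    idbArity zero    = outArgs
    idbArity (suc j) = pairArgs (decode finite-CodePair j)

    open DatalogSyntax Π (suc (card finite-CodePair)) idbArity public

    eqIdb : Code × Code → IdbSym
    eqIdb cc = suc (encode finite-CodePair cc)

    -- The arity of eqIdb cc is pairArgs (decode (encode cc)), equal to pairArgs cc only propositionally.
    eqArgs : {F : Ty Π → Set} (cc : Code × Code) → All F (pairArgs cc) → All F (idbArity (eqIdb cc))
    eqArgs {F} cc = subst (λ cc′ → All F (pairArgs cc′)) (sym (decode-encode finite-CodePair cc))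

    map-eqArgs : {F G : Ty Π → Set} (f : ∀ {t} → F t → G t) (cc : Code × Code)
                 (xs : All F (pairArgs cc)) → All.map f (eqArgs cc xs) ≡ eqArgs cc (All.map f xs)
    map-eqArgs {F} {G} f cc xs = map-subst (sym (decode-encode finite-CodePair cc))
      where
      map-subst : ∀ {cc′} (e : cc ≡ cc′) →
                  All.map f (subst (λ c → All F (pairArgs c)) e xs)
                    ≡ subst (λ c → All G (pairArgs c)) e (All.map f xs)
      map-subst refl = refl

    instantiate-eqArgs : ∀ {El : Ty Π → Set} {L} (ρ : ∀ t → Fin (occurrences L t) → El t) c c′
                         (ps : All (_∈ L) (indexTypes c)) (qs : All (_∈ L) (indexTypes c′)) →
                         All.map (λ {t} → ρ t) (eqArgs (c , c′) (vars (++⁺ ps qs)))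
                           ≡ eqArgs (c , c′) (++⁺ (instantiate ρ ps) (instantiate ρ qs))
    instantiate-eqArgs ρ c c′ ps qs = trans (map-eqArgs (λ {t} → ρ t) (c , c′) _) (cong (eqArgs (c , c′))
      (trans (cong (All.map (λ {t} → ρ t)) (map-++⁺ varOf ps qs))
             (map-++⁺ (λ {t} → ρ t) (vars ps) (vars qs))))

    eqAtom : ∀ {L} (c c′ : Code) → All (_∈ L) (indexTypes c) → All (_∈ L) (indexTypes c′) →
             Atom (occurrences L)
    eqAtom c c′ ps qs = atom (inj₂ (eqIdb (c , c′))) (eqArgs (c , c′) (vars (++⁺ ps qs)))

    eqRule : ∀ L (c c′ : Code) → All (_∈ L) (indexTypes c) → All (_∈ L) (indexTypes c′) →
             List (Atom (occurrences L)) → Rule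
    eqRule L c c′ ps qs body = record
      { nv = occurrences L ; head = eqIdb (c , c′) ; hargs = eqArgs (c , c′) (vars (++⁺ ps qs))
      ; body = body }

    inputAtom : ∀ {L} R → All (_∈ L) (ar Π R) → Atom (occurrences L)
    inputAtom R ps = atom (inj₁ R) (vars ps)

    domainAtoms : (c : Code) → List (Atom (occurrences (indexTypes c)))
    domainAtoms (V t s d) = []
    domainAtoms (E R s e) = inputAtom R (positions (ar Π R)) ∷ []

    CodeAt : List (Ty Π) → Set
    CodeAt L = Σ Code (λ c → All (_∈ L) (indexTypes c))

    outBody : ∀ {L ss} (ms : All MidTyOfSort ss) → All (λ u → All (_∈ L) (midArgs u)) (midTypes ms) →
              All (λ _ → CodeAt L) ss → List (Atom (occurrences L))
    outBody []             []       []              = []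
    outBody ((u , _) ∷ ms) (b ∷ bs) ((c , ps) ∷ cs) = eqAtom (codeOf u) c b ps ∷ outBody ms bs cs

    outBlocks : (L₂ : List (Ty Π)) → All (λ u → All (_∈ outArgs ++ L₂) (midArgs u)) (midTypes ms₀)
    outBlocks L₂ = All.map (All.map ∈-++⁺ˡ) (blockPositions midArgs (midTypes ms₀))

    select-outBlocks : ∀ {El : Ty Π → Set} {L₂} (W : All El (outArgs ++ L₂))
                       (ws : All (λ u → All El (midArgs u)) (midTypes ms₀)) →
                       select W (leftPositions outArgs L₂) ≡ flatten ws →
                       All.map (select W) (outBlocks L₂) ≡ ws
    select-outBlocks {L₂ = L₂} W ws left≡ws = begin
      All.map (select W) (All.map (All.map ∈-++⁺ˡ) B)
        ≡⟨ map-∘ B ⟩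
      All.map (λ ps → select W (All.map ∈-++⁺ˡ ps)) B
        ≡⟨ map-cong B (select-∈-++⁺ˡ-leftPositions W) ⟩
      All.map (select (select W (leftPositions outArgs L₂))) B
        ≡⟨ cong (λ z → All.map (select z) B) left≡ws ⟩
      All.map (select (flatten ws)) B
        ≡⟨ select-blockPositions midArgs ws ⟩
      ws ∎
      where
      open ≡-Reasoning
      B = blockPositions midArgs (midTypes ms₀)

    outRule : (L₂ : List (Ty Π)) → List (Atom (occurrences (outArgs ++ L₂))) →
              All (λ _ → CodeAt (outArgs ++ L₂)) (ar Σs S₀) → Rule
    outRule L₂ guard cs = record
      { nv = occurrences (outArgs ++ L₂) ; head = zero ; hargs = vars (leftPositions outArgs L₂)
      ; body = guard ++ outBody ms₀ (outBlocks L₂) cs }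

    rule : RuleName S₀ → Rule
    rule (glueing R {t} i s e) = eqRule (ar Π R) (E R s (fun (p γ R i) s e)) (V t s e) (positions _) (i ∷ [])
      (inputAtom R (positions _) ∷ [])
    rule (reflexivity c) = eqRule (indexTypes c) c c (positions _) (positions _) (domainAtoms c)
    rule (symmetry c c′) =
      eqRule (indexTypes c ++ indexTypes c′) c′ c (rightPositions _ _) (leftPositions _ _)
        (eqAtom c c′ (leftPositions _ _) (rightPositions _ _) ∷ [])
    rule (transitivity c c′ c″) = eqRule (indexTypes c ++ indexTypes c′ ++ indexTypes c″) c c″ P₁ P₃
      (eqAtom c c′ P₁ P₂ ∷ eqAtom c′ c″ P₂ P₃ ∷ [])
      where
      P₁ = firstPositions (indexTypes c) (indexTypes c′) (indexTypes c″)
      P₂ = secondPositions (indexTypes c) (indexTypes c′) (indexTypes c″)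
      P₃ = thirdPositions (indexTypes c) (indexTypes c′) (indexTypes c″)
    rule (outputD t d _) = outRule (t ∷ []) [] (All.map (λ {s} x → V t s x , rightPositions outArgs _) d)
    rule (outputR R e _) = outRule (ar Π R) (inputAtom R (rightPositions outArgs _) ∷ [])
      (All.map (λ {s} x → E R s x , rightPositions outArgs _) e)

    program : Program Π outArgs
    program = record { nIdb = suc (card finite-CodePair) ; idbAr = idbArity
                     ; rules = map rule (enumerate (finite-RuleName S₀)) ; outSym = inj₂ zero ; outOk = refl }

  interpretation : DatalogInterp Π midSig
  interpretation = record { outT = midArgs ; progT = λ u → domainProgram (codeOf u)
                          ; progR = λ R′ → SymbolProgram.program (decode finite-SymCode R′) }

  reduction : DatalogUReduction Π Σs
  reduction = record { mid = midSig ; interp = interpretation ; union = unionGadget }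

module Semantics {Π Σs : Signature} (γ : Gadget Π Σs) (A : FinStructure Π) where
  open Construction γ public
  open Replacement γ A public

  Tup : List (Ty Π) → Set
  Tup = All (FElt A)

  Valid : (c : Code) → Tup (indexTypes c) → Set
  Valid c = DatalogSemantics.Output (domainProgram c) A

  element : (c : Code) (w : Tup (indexTypes c)) → Valid c w → GElt (sort c)
  element (V t s d) (a ∷ []) _  = vert t a d
  element (E R s e) w        pa = edge R w pa e

  element-cong : ∀ c {w w′} → w ≡ w′ → (v : Valid c w) (v′ : Valid c w′) →
                 element c w v ≡ element c w′ v′
  element-cong (V t s d) {_ ∷ []} refl v v′ = refl
  element-cong (E R s e)          refl v v′ = cong (λ pa → edge R _ pa e) (T-irrelevant v v′)

  valid-V : ∀ t s d a → Valid (V t s d) (a ∷ [])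
  valid-V t s d a = subst (DatalogSemantics.Derivable (domainProgram (V t s d)) A zero)
    (cong (_∷ []) (env-varOf {El = FElt A} (a ∷ []) (here refl)))
    (DatalogSemantics.derive (domainRule t) (here refl) (env (a ∷ [])) [])

  MidElt : MidTy → Set
  MidElt u = Σ (Tup (midArgs u)) (Valid (codeOf u))

  midElement : (u : MidTy) → MidElt u → GElt (sort (codeOf u))
  midElement u (w , v) = element (codeOf u) w v

  toMidElt : (c : Code) → Σ (Tup (indexTypes c)) (Valid c) → MidElt (encode finite-Code c)
  toMidElt c = subst (λ c → Σ (Tup (indexTypes c)) (Valid c)) (sym (decode-encode finite-Code c))

  elements : ∀ {ss} (ms : All MidTyOfSort ss) → All MidElt (midTypes ms) → All GElt ss
  elements []             []       = []
  elements ((u , e) ∷ ms) (y ∷ ys) = subst GElt e (midElement u y) ∷ elements ms ys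

  eltCode : ∀ {s} → GElt s → Code
  eltCode {s} (vert t a d)    = V t s d
  eltCode {s} (edge R a pa e) = E R s e

  eltIndex : ∀ {s} (g : GElt s) → Tup (indexTypes (eltCode g))
  eltIndex (vert t a d)    = a ∷ []
  eltIndex (edge R a pa e) = a

  eltValid : ∀ {s} (g : GElt s) → Valid (eltCode g) (eltIndex g)
  eltValid {s} (vert t a d)    = valid-V t s d a
  eltValid     (edge R a pa e) = pa

  module _ {s : Ty Σs} where
    open Setoid (gdom s) public using ()
      renaming (sym to ≈G-sym; trans to ≈G-trans; reflexive to ≈G-reflexive)

  -- Identifies elements of possibly different sorts: the equality symbols range over all pairs of codes.
  data _≋_ : ∀ {s s′} → GElt s → GElt s′ → Set where
    ≋-intro : ∀ {s} {g g′ : GElt s} → g ≈G g′ → g ≋ g′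

  ≋-sym : ∀ {s s′} {g : GElt s} {g′ : GElt s′} → g ≋ g′ → g′ ≋ g
  ≋-sym (≋-intro g≈g′) = ≋-intro (≈G-sym g≈g′)

  ≋-trans : ∀ {s s′ s″} {g : GElt s} {g′ : GElt s′} {g″ : GElt s″} →
            g ≋ g′ → g′ ≋ g″ → g ≋ g″
  ≋-trans (≋-intro g≈g′) (≋-intro g′≈g″) = ≋-intro (≈G-trans g≈g′ g′≈g″)

  ≋-reflexive : ∀ {s} {g g′ : GElt s} → g ≡ g′ → g ≋ g′
  ≋-reflexive g≡g′ = ≋-intro (≈G-reflexive g≡g′)

  ≋⇒≈G : ∀ {s s′} {g : GElt s} {g′ : GElt s′} → g ≋ g′ → (e : s ≡ s′) → subst GElt e g ≈G g′
  ≋⇒≈G (≋-intro g≈g′) refl = g≈g′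

  SameElement : (c c′ : Code) → Tup (indexTypes c) → Tup (indexTypes c′) → Set
  SameElement c c′ w w′ =
    Σ (Valid c w) λ v → Σ (Valid c′ w′) λ v′ → element c w v ≋ element c′ w′ v′

  SameElement-sym : ∀ {c c′ w w′} → SameElement c c′ w w′ → SameElement c′ c w′ w
  SameElement-sym (v , v′ , g≋g′) = v′ , v , ≋-sym g≋g′

  SameElement-trans : ∀ {c c′ c″ w w′ w″} →
                      SameElement c c′ w w′ → SameElement c′ c″ w′ w″ → SameElement c c″ w w″
  SameElement-trans {c′ = c′} (v , v′ , g≋g′) (v″ , v‴ , g′≋g″) =
    v , v‴ , ≋-trans g≋g′ (≋-trans (≋-reflexive (element-cong c′ refl v′ v″)) g′≋g″)

module SymbolSoundness {Π Σs : Signature} (γ : Gadget Π Σs) (A : FinStructure Π)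
                       (k : Construction.SymCode γ) where
  open Semantics γ A
  open SymbolProgram k
  open DatalogSemantics program A using (Derivable; Holds; derive; holdsIn; holdsIdb; holdsEq)

  Env : List (Ty Π) → Set
  Env L = ∀ t → Fin (occurrences L t) → FElt A t

  SamePair : (cc : Code × Code) → Tup (pairArgs cc) → Set
  SamePair (c , c′) z = SameElement c c′ (++⁻ˡ (indexTypes c) z) (++⁻ʳ (indexTypes c) z)

  -- Quantifies over all splittings of z into valid blocks, as the validity proofs are not part of z.
  OutputSound : Tup outArgs → Set
  OutputSound z =
    (ys : All MidElt (midTypes ms₀)) → flatten (All.map proj₁ ys) ≡ z → grel S₀ (elements ms₀ ys)

  Meaning : (j : IdbSym) → Tup (idbArity j) → Set
  Meaning zero    = OutputSound
  Meaning (suc j) = SamePair (decode finite-CodePair j)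

  ⟦_⟧ : ∀ {nv} → Atom nv → (∀ t → Fin (nv t) → FElt A t) → Set
  ⟦ atom (inj₁ R) xs ⟧ ρ = T (frel A R (All.map (λ {t} → ρ t) xs))
  ⟦ atom (inj₂ j) xs ⟧ ρ = Meaning j (All.map (λ {t} → ρ t) xs)
  ⟦ eq t x y ⟧        ρ = ρ t x ≡ ρ t y

  SoundRule : Rule → Set
  SoundRule r =
    ∀ ρ → All (λ a → ⟦ a ⟧ ρ) (body r) → Meaning (head r) (All.map (λ {t} → ρ t) (hargs r))

  meaning-eqArgs : ∀ c c′ w w′ →
                   Meaning (eqIdb (c , c′)) (eqArgs (c , c′) (++⁺ w w′)) ≡ SameElement c c′ w w′
  meaning-eqArgs c c′ w w′ =
    trans (transport (sym (decode-encode finite-CodePair (c , c′))))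
          (cong₂ (SameElement c c′) (++⁻ˡ-++⁺ w w′) (++⁻ʳ-++⁺ w w′))
    where
    transport : ∀ {cc} (e : (c , c′) ≡ cc) →
                SamePair cc (subst (λ cc → Tup (pairArgs cc)) e (++⁺ w w′))
                  ≡ SamePair (c , c′) (++⁺ w w′)
    transport refl = refl

  meaning-eqAtom : ∀ {L} (ρ : Env L) c c′ (ps : All (_∈ L) (indexTypes c))
                   (qs : All (_∈ L) (indexTypes c′)) →
                   ⟦ eqAtom c c′ ps qs ⟧ ρ ≡ SameElement c c′ (select (slots ρ) ps) (select (slots ρ) qs)
  meaning-eqAtom ρ c c′ ps qs = begin
    Meaning (eqIdb (c , c′)) (All.map (λ {t} → ρ t) (eqArgs (c , c′) (vars (++⁺ ps qs))))
      ≡⟨ cong (Meaning (eqIdb (c , c′))) (instantiate-eqArgs ρ c c′ ps qs) ⟩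
    Meaning (eqIdb (c , c′)) (eqArgs (c , c′) (++⁺ (instantiate ρ ps) (instantiate ρ qs)))
      ≡⟨ cong₂ (λ w w′ → Meaning (eqIdb (c , c′)) (eqArgs (c , c′) (++⁺ w w′)))
               (instantiate-slots ρ ps) (instantiate-slots ρ qs) ⟩
    Meaning (eqIdb (c , c′)) (eqArgs (c , c′) (++⁺ (select (slots ρ) ps) (select (slots ρ) qs)))
      ≡⟨ meaning-eqArgs c c′ _ _ ⟩
    SameElement c c′ (select (slots ρ) ps) (select (slots ρ) qs) ∎
    where open ≡-Reasoning

  eqAtom-sound : ∀ {L} (ρ : Env L) c c′ (ps : All (_∈ L) (indexTypes c)) (qs : All (_∈ L) (indexTypes c′)) →
                 ⟦ eqAtom c c′ ps qs ⟧ ρ →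
                 SameElement c c′ (select (slots ρ) ps) (select (slots ρ) qs)
  eqAtom-sound ρ c c′ ps qs = subst id (meaning-eqAtom ρ c c′ ps qs)

  eqRule-sound : ∀ {L} c c′ (ps : All (_∈ L) (indexTypes c)) (qs : All (_∈ L) (indexTypes c′)) body →
                 (∀ ρ → All (λ a → ⟦ a ⟧ ρ) body →
                        SameElement c c′ (select (slots ρ) ps) (select (slots ρ) qs)) →
                 SoundRule (eqRule L c c′ ps qs body)
  eqRule-sound c c′ ps qs body same ρ hs = subst id (sym (meaning-eqAtom ρ c c′ ps qs)) (same ρ hs)

  domainAtoms-valid : ∀ c (ρ : Env (indexTypes c)) →
                      All (λ a → ⟦ a ⟧ ρ) (domainAtoms c) → Valid c (slots ρ)
  domainAtoms-valid (V t s d) ρ []        = valid-V t s d _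
  domainAtoms-valid (E R s e) ρ (pa ∷ []) = pa

  select-outBlocks-slots : ∀ {L₂} (ρ : Env (outArgs ++ L₂)) (ys : All MidElt (midTypes ms₀)) →
                           flatten (All.map proj₁ ys) ≡ instantiate ρ (leftPositions outArgs L₂) →
                           All.map (select (slots ρ)) (outBlocks L₂) ≡ All.map proj₁ ys
  select-outBlocks-slots ρ ys flat =
    select-outBlocks (slots ρ) (All.map proj₁ ys) (trans (sym (instantiate-slots ρ _)) (sym flat))

  Targets : ∀ {L ss} → Env L → All (λ _ → CodeAt L) ss → All GElt ss → Set
  Targets ρ []              []       = ⊤
  Targets ρ ((c , ps) ∷ cs) (g ∷ gs) = (∀ v → element c (select (slots ρ) ps) v ≋ g) × Targets ρ cs gs

  outBody-sound : ∀ {L ss} (ρ : Env L) (ms : All MidTyOfSort ss) (ys : All MidElt (midTypes ms))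
                  (bs : All (λ u → All (_∈ L) (midArgs u)) (midTypes ms)) (cs : All (λ _ → CodeAt L) ss)
                  (gs : All GElt ss) → All.map (select (slots ρ)) bs ≡ All.map proj₁ ys → Targets ρ cs gs →
                  All (λ a → ⟦ a ⟧ ρ) (outBody ms bs cs) → Pointwise _≈G_ (elements ms ys) gs
  outBody-sound ρ [] [] [] [] [] _ _ _ = tt
  outBody-sound ρ ((u , e) ∷ ms) ((w , v) ∷ ys) (b ∷ bs) ((c , ps) ∷ cs) (g ∷ gs) blocks (hit , hits) (h ∷ hs)
    = ≋⇒≈G (≋-trans (≋-reflexive (element-cong (codeOf u) (sym (cong All.head blocks)) v v₁))
                    (≋-trans same (hit v′))) e
    , outBody-sound ρ ms ys bs cs gs (cong All.tail blocks) hits hs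
    where
    sameElement = eqAtom-sound ρ (codeOf u) c b ps h
    v₁   = proj₁ sameElement
    v′   = proj₁ (proj₂ sameElement)
    same = proj₂ (proj₂ sameElement)

  rule-sound : (n : RuleName S₀) → SoundRule (rule n)
  rule-sound (glueing R {t} i s e) = eqRule-sound _ _ _ _ _ λ { ρ (pa ∷ []) →
    subst (λ w → SameElement (E R s (fun (p γ R i) s e)) (V t s e) w (All.lookup (slots ρ) i ∷ []))
          (sym (select-positions (slots ρ)))
          (pa , valid-V t s e _ , ≋-intro (EqC.return (glue R (slots ρ) pa i e))) }
  rule-sound (reflexivity c) = eqRule-sound _ _ _ _ _ λ ρ hs →
    let v = domainAtoms-valid c ρ hs in
    subst (λ w → SameElement c c w w) (sym (select-positions (slots ρ))) (v , v , ≋-reflexive refl)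
  rule-sound (symmetry c c′) =
    eqRule-sound c′ c (rightPositions I I′) (leftPositions I I′) _ λ { ρ (h ∷ []) →
      SameElement-sym (eqAtom-sound ρ c c′ (leftPositions I I′) (rightPositions I I′) h) }
    where
    I  = indexTypes c
    I′ = indexTypes c′
  rule-sound (transitivity c c′ c″) = eqRule-sound _ _ _ _ _ λ { ρ (h ∷ h′ ∷ []) →
    SameElement-trans (eqAtom-sound ρ c c′ (firstPositions I I′ I″) (secondPositions I I′ I″) h)
                      (eqAtom-sound ρ c′ c″ (secondPositions I I′ I″) (thirdPositions I I′ I″) h′) }
    where
    I  = indexTypes c
    I′ = indexTypes c′
    I″ = indexTypes c″
  rule-sound (outputD t d ok) ρ hs ys flat =
    inj₁ (t , _ , d , ok ,
          outBody-sound ρ ms₀ ys (outBlocks (t ∷ [])) _ _ (select-outBlocks-slots ρ ys flat) (hits d) hs)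
    where
    a = All.lookup (slots ρ) (∈-++⁺ʳ outArgs (here refl))
    hits : ∀ {ss} (d : All (FElt (D γ t)) ss) →
           Targets ρ (All.map (λ {s} x → V t s x , rightPositions outArgs _) d)
                     (All.map (λ {s} → vert t a) d)
    hits []      = tt
    hits (x ∷ d) = (λ _ → ≋-reflexive refl) , hits d
  rule-sound (outputR R e ok) ρ (pa ∷ hs) ys flat =
    inj₂ (R , _ , pb , e , ok ,
          outBody-sound ρ ms₀ ys (outBlocks (ar Π R)) _ _ (select-outBlocks-slots ρ ys flat) (hits e) hs)
    where
    pb : T (frel A R (select (slots ρ) (rightPositions outArgs (ar Π R))))
    pb = subst (λ b → T (frel A R b)) (instantiate-slots ρ (rightPositions outArgs (ar Π R))) pa
    hits : ∀ {ss} (e : All (FElt (Rg γ R)) ss) →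
           Targets ρ (All.map (λ {s} x → E R s x , rightPositions outArgs _) e)
                     (All.map (λ {s} → edge R _ pb) e)
    hits []      = tt
    hits (x ∷ e) = (λ v → ≋-reflexive (cong (λ q → edge R _ q x) (T-irrelevant v pb))) , hits e

  rules-sound : All SoundRule (rules program)
  rules-sound = map⁺ (All.tabulate λ {n} _ → rule-sound n)

  mutual
    derivable-sound : ∀ {j z} → Derivable j z → Meaning j z
    derivable-sound (derive r r∈ ρ hs) = All.lookup rules-sound r∈ ρ (holds-sound hs)

    holds-sound : ∀ {nv ρ} {as : List (Atom nv)} → All (Holds nv ρ) as → All (λ a → ⟦ a ⟧ ρ) as
    holds-sound []                     = []
    holds-sound (holdsIn R xs pa ∷ hs) = pa ∷ holds-sound hs
    holds-sound (holdsIdb j xs d ∷ hs) = derivable-sound d ∷ holds-sound hs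
    holds-sound (holdsEq t x y e ∷ hs) = e ∷ holds-sound hs

  output-sound : (ys : All MidElt (midTypes ms₀)) → Derivable zero (flatten (All.map proj₁ ys)) →
                 grel S₀ (elements ms₀ ys)
  output-sound ys d = derivable-sound d ys refl

module SymbolCompleteness {Π Σs : Signature} (γ : Gadget Π Σs) (A : FinStructure Π)
                          (k : Construction.SymCode γ) where
  open Semantics γ A
  open SymbolProgram k public
  open DatalogSemantics program A using (Derivable; Holds; derive; holdsIn; holdsIdb)

  DerivableEq : (c c′ : Code) → Tup (indexTypes c) → Tup (indexTypes c′) → Set
  DerivableEq c c′ w w′ = Derivable (eqIdb (c , c′)) (eqArgs (c , c′) (++⁺ w w′))

  rule∈ : (n : RuleName S₀) → rule n ∈ rules program
  rule∈ n = ∈-map⁺ rule (∈-enumerate (finite-RuleName S₀) n)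

  env-eqArgs : ∀ {L} (W : Tup L) c c′ (ps : All (_∈ L) (indexTypes c)) (qs : All (_∈ L) (indexTypes c′)) →
               All.map (λ {t} → env W t) (eqArgs (c , c′) (vars (++⁺ ps qs)))
                 ≡ eqArgs (c , c′) (++⁺ (select W ps) (select W qs))
  env-eqArgs W c c′ ps qs = trans (instantiate-eqArgs (env W) c c′ ps qs)
    (cong₂ (λ w w′ → eqArgs (c , c′) (++⁺ w w′)) (instantiate-env W ps) (instantiate-env W qs))

  eqAtom-holds : ∀ {L} (W : Tup L) {c c′} (ps : All (_∈ L) (indexTypes c)) (qs : All (_∈ L) (indexTypes c′))
                 {w w′} → select W ps ≡ w → select W qs ≡ w′ → DerivableEq c c′ w w′ →
                 Holds (occurrences L) (env W) (eqAtom c c′ ps qs)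
  eqAtom-holds W {c} {c′} ps qs refl refl d =
    holdsIdb _ _ (subst (Derivable _) (sym (env-eqArgs W c c′ ps qs)) d)

  inputAtom-holds : ∀ {L} (W : Tup L) R (ps : All (_∈ L) (ar Π R)) {w} →
                    select W ps ≡ w → T (frel A R w) → Holds (occurrences L) (env W) (inputAtom R ps)
  inputAtom-holds W R ps refl pa = holdsIn R _ (subst (λ w → T (frel A R w)) (sym (instantiate-env W ps)) pa)

  eqRule-fires : ∀ {L} (W : Tup L) {c c′} (ps : All (_∈ L) (indexTypes c)) (qs : All (_∈ L) (indexTypes c′))
                 {w w′} body → eqRule L c c′ ps qs body ∈ rules program →
                 select W ps ≡ w → select W qs ≡ w′ → All (Holds (occurrences L) (env W)) body →
                 DerivableEq c c′ w w′
  eqRule-fires W {c} {c′} ps qs body r∈ refl refl hs =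
    subst (Derivable _) (env-eqArgs W c c′ ps qs) (derive _ r∈ (env W) hs)

  derivable-glue : ∀ R (a : Tup (ar Π R)) (pa : T (frel A R a)) {t} (i : t ∈ ar Π R) s e →
                   DerivableEq (E R s (fun (p γ R i) s e)) (V t s e) a (All.lookup a i ∷ [])
  derivable-glue R a pa i s e = eqRule-fires a (positions _) (i ∷ []) _ (rule∈ (glueing R i s e))
    (select-positions a) refl (inputAtom-holds a R (positions _) (select-positions a) pa ∷ [])

  derivable-refl : ∀ c w → Valid c w → DerivableEq c c w w
  derivable-refl c w v = eqRule-fires w (positions _) (positions _) _ (rule∈ (reflexivity c))
    (select-positions w) (select-positions w) (domain c v)
    where
    domain : ∀ c {w} → Valid c w → All (Holds _ (env w)) (domainAtoms c)
    domain (V t s d)     v  = []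
    domain (E R s e) {w} pa = inputAtom-holds w R (positions _) (select-positions w) pa ∷ []

  derivable-sym : ∀ {c c′ w w′} → DerivableEq c c′ w w′ → DerivableEq c′ c w′ w
  derivable-sym {c} {c′} {w} {w′} d =
    eqRule-fires W (rightPositions _ _) (leftPositions _ _) _ (rule∈ (symmetry c c′)) right left
      (eqAtom-holds W (leftPositions _ _) (rightPositions _ _) left right d ∷ [])
    where
    W     = ++⁺ w w′
    left  = select-leftPositions w w′
    right = select-rightPositions w w′

  derivable-trans : ∀ {c c′ c″ w w′ w″} →
                    DerivableEq c c′ w w′ → DerivableEq c′ c″ w′ w″ → DerivableEq c c″ w w″
  derivable-trans {c} {c′} {c″} {w} {w′} {w″} d d′ =
    eqRule-fires W (firstPositions I I′ I″) (thirdPositions I I′ I″) _ (rule∈ (transitivity c c′ c″))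
      first third
      (eqAtom-holds W (firstPositions I I′ I″) (secondPositions I I′ I″) first second d
       ∷ eqAtom-holds W (secondPositions I I′ I″) (thirdPositions I I′ I″) second third d′ ∷ [])
    where
    I      = indexTypes c
    I′     = indexTypes c′
    I″     = indexTypes c″
    W      = ++⁺ w (++⁺ w′ w″)
    first  = select-firstPositions w w′ w″
    second = select-secondPositions w w′ w″
    third  = select-thirdPositions w w′ w″

  SameDerivable : ∀ {s} → GElt s → GElt s → Set
  SameDerivable g g′ = DerivableEq (eltCode g) (eltCode g′) (eltIndex g) (eltIndex g′)

  SameDerivable-isEquivalence : ∀ {s} → IsEquivalence (SameDerivable {s})
  SameDerivable-isEquivalence = record
    { refl  = λ {g} → derivable-refl (eltCode g) (eltIndex g) (eltValid g)
    ; sym   = λ {g g′} → derivable-sym {w = eltIndex g} {w′ = eltIndex g′}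
    ; trans = λ {g g′ g″} → derivable-trans {w = eltIndex g} {w′ = eltIndex g′} {w″ = eltIndex g″} }

  ≈G⇒derivable : ∀ {s} {g g′ : GElt s} → g ≈G g′ → SameDerivable g g′
  ≈G⇒derivable = EqC.fold SameDerivable-isEquivalence λ { (glue R a pa i e) → derivable-glue R a pa i _ e }

  derivable-toMidElt : ∀ c (wv : Σ (Tup (indexTypes c)) (Valid c)) {c′ z} → DerivableEq c c′ (proj₁ wv) z →
                       DerivableEq (codeOf (encode finite-Code c)) c′ (proj₁ (toMidElt c wv)) z
  derivable-toMidElt c wv {c′} {z} d = transport (sym (decode-encode finite-Code c))
    where
    transport : ∀ {c₀} (e : c ≡ c₀) →
                DerivableEq c₀ c′ (proj₁ (subst (λ c → Σ (Tup (indexTypes c)) (Valid c)) e wv)) z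
    transport refl = d

  Linked : ∀ {L ss} → Tup L → (ms : All MidTyOfSort ss) → All (λ u → Tup (midArgs u)) (midTypes ms) →
           All (λ _ → CodeAt L) ss → Set
  Linked W []             []       []              = ⊤
  Linked W ((u , _) ∷ ms) (w ∷ ws) ((c , ps) ∷ cs) = DerivableEq (codeOf u) c w (select W ps) × Linked W ms ws cs

  outBody-holds : ∀ {L ss} (W : Tup L) (ms : All MidTyOfSort ss) (ws : All (λ u → Tup (midArgs u)) (midTypes ms))
                  (bs : All (λ u → All (_∈ L) (midArgs u)) (midTypes ms)) (cs : All (λ _ → CodeAt L) ss) →
                  All.map (select W) bs ≡ ws → Linked W ms ws cs →
                  All (Holds (occurrences L) (env W)) (outBody ms bs cs)
  outBody-holds W []             []       []       []              _      _        = []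
  outBody-holds W ((u , _) ∷ ms) (w ∷ ws) (b ∷ bs) ((c , ps) ∷ cs) blocks (d , ds) =
    eqAtom-holds W b ps (cong All.head blocks) refl d ∷ outBody-holds W ms ws bs cs (cong All.tail blocks) ds

  outRule-fires : ∀ {L₂} (ws : All (λ u → Tup (midArgs u)) (midTypes ms₀)) (z : Tup L₂) guard cs →
                  outRule L₂ guard cs ∈ rules program → All (Holds _ (env (++⁺ (flatten ws) z))) guard →
                  Linked (++⁺ (flatten ws) z) ms₀ ws cs → Derivable zero (flatten ws)
  outRule-fires ws z guard cs r∈ hs ds =
    subst (Derivable zero) (trans (instantiate-env W _) left≡ws)
      (derive _ r∈ (env W)
        (++⁺ hs (outBody-holds W ms₀ ws (outBlocks _) cs (select-outBlocks W ws left≡ws) ds)))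
    where
    W       = ++⁺ (flatten ws) z
    left≡ws = select-leftPositions (flatten ws) z

module CanonicalRepresentatives {Π Σs : Signature} (γ : Gadget Π Σs) (A : FinStructure Π) where
  open Semantics γ A

  finite-GElt : ∀ s → Finite (GElt s)
  finite-GElt s = finite-retract split join join-split
    (finite-⊎ (finite-Σ (finite-Fin _) λ t → finite-Σ (finite-Fin _) λ a → finite-Fin (size (D γ t) s))
              (finite-Σ (finite-Fin _) λ R →
                 finite-Σ (finite-Σ (finite-All (ar Π R) λ _ → finite-Fin _) λ a → finite-T _) λ _ →
                 finite-Fin (size (Rg γ R) s)))
    where
    split : GElt s → _
    split (vert t a d)    = inj₁ (t , a , d)
    split (edge R a pa e) = inj₂ (R , (a , pa) , e)
    join : _ → GElt s
    join (inj₁ (t , a , d))        = vert t a d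
    join (inj₂ (R , (a , pa) , e)) = edge R a pa e
    join-split : ∀ g → join (split g) ≡ g
    join-split (vert t a d)    = refl
    join-split (edge R a pa e) = refl

  GlueInstance : Ty Σs → Set
  GlueInstance s = Σ (Sym Π) λ R → Σ (Σ (Tup (ar Π R)) λ a → T (frel A R a)) λ _ →
                   Σ (Σ (Ty Π) (_∈ ar Π R)) λ ti → FElt (D γ (proj₁ ti)) s

  finite-GlueInstance : ∀ s → Finite (GlueInstance s)
  finite-GlueInstance s = finite-Σ (finite-Fin _) λ R →
    finite-Σ (finite-Σ (finite-All (ar Π R) λ _ → finite-Fin _) λ a → finite-T _) λ _ →
    finite-Σ (finite-∈ (ar Π R)) λ ti → finite-Fin _

  glued : ∀ {s} → GlueInstance s → GElt s × GElt s
  glued {s} (R , (a , pa) , (t , i) , e) = edge R a pa (fun (p γ R i) s e) , vert t (All.lookup a i) e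

  gluedPairs : ∀ s → List (GElt s × GElt s)
  gluedPairs s = map glued (enumerate (finite-GlueInstance s))

  module _ {s : Ty Σs} where
    open Representatives (gdom s) (≟-finite (finite-GElt s))

    canonical : GElt s → GElt s
    canonical = representative (gluedPairs s)

    canonical-≈ : ∀ g → canonical g ≈G g
    canonical-≈ = representative-≈ {gluedPairs s}
      (map⁺ (All.tabulate λ { {R , (a , pa) , (t , i) , e} _ → EqC.return (glue R a pa i e) }))

    canonical-cong : ∀ {g g′} → g ≈G g′ → canonical g ≡ canonical g′
    canonical-cong = EqC.gfold isEquivalence canonical λ { (glue R a pa {t} i e) →
      representative-identifies (gluedPairs s)
        (∈-map⁺ glued (∈-enumerate (finite-GlueInstance s) (R , (a , pa) , (t , i) , e))) }

module Homomorphisms {Π Σs : Signature} (γ : Gadget Π Σs) (A : FinStructure Π) where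
  open Semantics γ A
  open CanonicalRepresentatives γ A
  open UnionApply unionGadget (interpret interpretation A)

  sort-eltCode : ∀ {s} (g : GElt s) → sort (eltCode g) ≡ s
  sort-eltCode (vert t a d)    = refl
  sort-eltCode (edge R a pa e) = refl

  embed : ∀ {s} → GElt s → UElt s
  embed g = uelt (encode finite-Code (eltCode g))
                 (trans (cong sort (decode-encode finite-Code (eltCode g))) (sort-eltCode g))
                 (toMidElt (eltCode g) (eltIndex g , eltValid g))

  -- ψ(A) identifies two elements only when their tuples are equal, hence the canonical member.
  lift : ∀ s → GElt s → UElt s
  lift s g = embed (canonical g)

  lift-cong : ∀ s {g g′} → g ≈G g′ → lift s g ≈U lift s g′
  lift-cong s g≈g′ = Setoid.reflexive (udom s) (cong embed (canonical-cong g≈g′))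

  midTypesOf : ∀ {ss} → All GElt ss → All MidTyOfSort ss
  midTypesOf {[]}    []       = []
  midTypesOf {s ∷ _} (g ∷ gs) = (UElt.src (lift s g) , UElt.ok (lift s g)) ∷ midTypesOf gs

  midEltsOf : ∀ {ss} (gs : All GElt ss) → All MidElt (midTypes (midTypesOf gs))
  midEltsOf {[]}    []       = []
  midEltsOf {s ∷ _} (g ∷ gs) = UElt.val (lift s g) ∷ midEltsOf gs

  match-midEltsOf : ∀ {ss} (gs : All GElt ss) → Match (All.map (λ {s} → lift s) gs) (midEltsOf gs)
  match-midEltsOf {[]}    []       = []
  match-midEltsOf {s ∷ _} (g ∷ gs) = _∷_ (UElt.ok (lift s g)) (ueq refl) (match-midEltsOf gs)

  output-derivable : ∀ S (x : All GElt (ar Σs S)) → grel S x →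
                     DatalogSemantics.Derivable (SymbolProgram.program (S , midTypesOf x)) A zero
                       (flatten (All.map proj₁ (midEltsOf x)))
  output-derivable S x (inj₁ (t , a , d , ok , x≈)) =
    outRule-fires ws (a ∷ []) [] _ (rule∈ (outputD t d ok)) [] (linked x d x≈)
    where
    open SymbolCompleteness γ A (S , midTypesOf x)
    ws = All.map proj₁ (midEltsOf x)
    linked : ∀ {ss} (x′ : All GElt ss) (d′ : All (FElt (D γ t)) ss) →
             Pointwise _≈G_ x′ (All.map (vert t a) d′) →
             Linked (++⁺ (flatten ws) (a ∷ [])) (midTypesOf x′) (All.map proj₁ (midEltsOf x′))
                    (All.map (λ {s} y → V t s y , rightPositions outArgs (t ∷ [])) d′)
    linked []       []       _          = tt
    linked (g ∷ x′) (y ∷ d′) (g≈ , x′≈) =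
      subst (DerivableEq _ _ _) (sym (select-rightPositions (flatten ws) (a ∷ [])))
            (derivable-toMidElt _ _ (≈G⇒derivable (≈G-trans (canonical-≈ g) g≈)))
      , linked x′ d′ x′≈
  output-derivable S x (inj₂ (R , b , pb , e , ok , x≈)) =
    outRule-fires ws b _ _ (rule∈ (outputR R e ok))
      (inputAtom-holds _ R _ (select-rightPositions (flatten ws) b) pb ∷ []) (linked x e x≈)
    where
    open SymbolCompleteness γ A (S , midTypesOf x)
    ws = All.map proj₁ (midEltsOf x)
    linked : ∀ {ss} (x′ : All GElt ss) (e′ : All (FElt (Rg γ R)) ss) →
             Pointwise _≈G_ x′ (All.map (edge R b pb) e′) →
             Linked (++⁺ (flatten ws) b) (midTypesOf x′) (All.map proj₁ (midEltsOf x′))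
                    (All.map (λ {s} y → E R s y , rightPositions outArgs (ar Π R)) e′)
    linked []       []       _          = tt
    linked (g ∷ x′) (y ∷ e′) (g≈ , x′≈) =
      subst (DerivableEq _ _ _) (sym (select-rightPositions (flatten ws) b))
            (derivable-toMidElt _ _ (≈G⇒derivable (≈G-trans (canonical-≈ g) g≈)))
      , linked x′ e′ x′≈

  urel-intro : ∀ (k : SymCode) {x : All UElt (ar Σs (proj₁ k))} (y : All MidElt (midTypes (proj₂ k))) →
               DatalogSemantics.Derivable (SymbolProgram.program k) A zero (flatten (All.map proj₁ y)) →
               Match x y → urel (proj₁ k) x
  urel-intro k {x} y d m =
    encode finite-SymCode k , subst Witness (sym (decode-encode finite-SymCode k)) (refl , y , d , m)
    where
    Witness : SymCode → Set
    Witness k′ = proj₁ k′ ≡ proj₁ k × Σ (All MidElt (midTypes (proj₂ k′))) λ y →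
      DatalogSemantics.Derivable (SymbolProgram.program k′) A zero (flatten (All.map proj₁ y)) × Match x y

  lift-pres : ∀ S (x : All GElt (ar Σs S)) → grel S x → urel S (All.map (λ {s} → lift s) x)
  lift-pres S x x∈S = urel-intro (S , midTypesOf x) (midEltsOf x) (output-derivable S x x∈S) (match-midEltsOf x)

  lift-hom : Hom (replace γ A) (applyReduction reduction A)
  lift-hom = record { fun = lift ; cong = lift-cong ; pres = lift-pres }

  project : ∀ s → UElt s → GElt s
  project s (uelt u ok y) = subst GElt ok (midElement u y)

  project-cong : ∀ s {x y : UElt s} → x ≈U y → project s x ≈G project s y
  project-cong s (ueq {u} {ok} {ok′} {y} {y′} y≡y′) =
    ≈G-reflexive (cong₂ (subst GElt) (uip ok ok′) (element-cong (codeOf u) y≡y′ (proj₂ y) (proj₂ y′)))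

  pointwise-trans : ∀ {ss} {x y z : All GElt ss} →
                    Pointwise _≈G_ x y → Pointwise _≈G_ y z → Pointwise _≈G_ x z
  pointwise-trans {[]}    {[]}    {[]}    {[]}    _        _        = tt
  pointwise-trans {_ ∷ _} {_ ∷ _} {_ ∷ _} {_ ∷ _} (p , ps) (q , qs) = ≈G-trans p q , pointwise-trans ps qs

  grel-resp : ∀ S {x x′} → Pointwise _≈G_ x′ x → grel S x → grel S x′
  grel-resp S x′≈x (inj₁ (t , a , d , ok , x≈))      = inj₁ (t , a , d , ok , pointwise-trans x′≈x x≈)
  grel-resp S x′≈x (inj₂ (R , b , pb , e , ok , x≈)) = inj₂ (R , b , pb , e , ok , pointwise-trans x′≈x x≈)

  match⇒pointwise : ∀ {ss} (ms : All MidTyOfSort ss) {x : All UElt ss} {y : All MidElt (midTypes ms)} →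
                    Match x y → Pointwise _≈G_ (All.map (λ {s} → project s) x) (elements ms y)
  match⇒pointwise []             []            = tt
  match⇒pointwise ((u , e) ∷ ms) (_∷_ e′ x≈ m) =
    ≈G-trans (project-cong _ x≈) (≈G-reflexive (cong (λ q → subst GElt q (midElement u _)) (uip e′ e)))
    , match⇒pointwise ms m

  project-pres : ∀ S (x : All UElt (ar Σs S)) → urel S x → grel S (All.map (λ {s} → project s) x)
  project-pres .(proj₁ (decode finite-SymCode R′)) x (R′ , refl , y , derivable , m) =
    grel-resp _ (match⇒pointwise (proj₂ (decode finite-SymCode R′)) m)
      (SymbolSoundness.output-sound γ A (decode finite-SymCode R′) y derivable)

  project-hom : Hom (applyReduction reduction A) (replace γ A)
  project-hom = record { fun = project ; cong = project-cong ; pres = project-pres }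

theorem3p9 : {Π Σs : Signature} (γ : Gadget Π Σs) →
    Σ (DatalogUReduction Π Σs) (λ ψ →
    (A : FinStructure Π) → HomEquivalent (replace γ A) (applyReduction ψ A))
theorem3p9 γ = Construction.reduction γ , λ A → Homomorphisms.lift-hom γ A , Homomorphisms.project-hom γ A
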